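{- For each $n\in\mathbb{N}$ with $n\ge1$ and each bijection $\rho$ of $\{1,\dots,n\}$, the instruction sequence obtained from $\mathrm{TSTNZ}'_n$ by replacing, for each $j\le n$, every occurrence of the register name $\mathtt{in}{:}j$ by $\mathtt{in}{:}\rho(j)$ computes $\mathrm{tstnz}_n$.
   Context: Basic instructions: $\mathtt{in}{:}i.\mathtt{get}$ ($i\ge1$), $\mathtt{out}.\mathtt{set}{:}b$ ($b\in\{0,1\}$), $\mathtt{aux}{:}i.\mathtt{get}$ ($i\ge1$), $\mathtt{aux}{:}i.\mathtt{set}{:}b$ ($i\ge1$, $b\in\{0,1\}$). The part before the dot names a Boolean register ($\mathtt{in}{:}i$ input, $\mathtt{out}$ output, $\mathtt{aux}{:}i$ auxiliary); $\mathtt{get}$ changes nothing and replies the content, $\mathtt{set}{:}b$ makes the content $b$ and replies $b$. Primitive instructions: for each basic instruction $a$, plain $a$, positive test $+a$, negative test $-a$; forward jumps $\#l$ ($l\in\mathbb{N}$); termination $!$. Instruction sequences are finite sequences $u_1;\dots;u_k$ of primitive instructions; ${;}_{i=p}^{q}P_i$ denotes the concatenation $P_p;\dots;P_q$ (empty if $p>q$). Execution starts at $u_1$: plain $a$ executes $a$ and proceeds with the next instruction; $+a$ executes $a$ and proceeds with the next instruction if the reply is $1$, otherwise skips the next one and proceeds with the one after it; $-a$ likewise with replies reversed; $\#l$ proceeds with the $l$-th next instruction; $!$ terminates. If $l=0$ or there is no instruction to proceed with, execution never terminates. For $f:\{0,1\}^n\to\{0,1\}$, $X$ computes $f$ if there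 is $k$ such that for all $b_1,\dots,b_n$, executing $X$ with $\mathtt{in}{:}i$ initially $b_i$, $\mathtt{out}$ and $\mathtt{aux}{:}1,\dots,\mathtt{aux}{:}k$ initially $0$ terminates with final content of $\mathtt{out}$ equal to $f(b_1,\dots,b_n)$. $\mathrm{tstnz}_n(b_1,\dots,b_n)=1$ iff some $b_i=1$. $\mathrm{TSTNZ}'_n={;}_{i=1}^{n/2}\big(-\mathtt{in}{:}(2i-1).\mathtt{get};+\mathtt{in}{:}2i.\mathtt{get};\mathtt{out}.\mathtt{set}{:}1\big);!$ if $n$ is even, and $\mathrm{TSTNZ}'_n=+\mathtt{in}{:}1.\mathtt{get};\mathtt{out}.\mathtt{set}{:}1;{;}_{i=1}^{(n-1)/2}\big(-\mathtt{in}{:}2i.\mathtt{get};+\mathtt{in}{:}(2i+1).\mathtt{get};\mathtt{out}.\mathtt{set}{:}1\big);!$ if $n$ is odd. -}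

module Defs where

open import Data.Bool using (Bool; true; false; if_then_else_; not)
open import Data.Nat using (ℕ; zero; suc; _+_; _*_; _∸_; _≤_; _<_; _<ᵇ_; ⌊_/2⌋)
open import Data.Fin using (Fin; toℕ; fromℕ<)
open import Data.Fin.Properties using ()
open import Data.List using (List; []; _∷_; _++_; allFin)
open import Data.Bool.ListAction using (any)
open import Data.Maybe using (Maybe; just; nothing)
open import Data.Product using (Σ; ∃; _×_; _,_)
open import Function.Bundles using (_↔_; Inverse)
open import Relation.Binary.PropositionalEquality using (_≡_)
open import Relation.Nullary using (yes; no)
open import Data.Nat using (_<?_)

-- Basic instructions.  Register indices are 1-based natural numbers
-- (in:0 / aux:0 never occur in the sequences considered).
data Basic : Set where
  inGet  : ℕ → Basic
  outSet : Bool → Basic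
  auxGet : ℕ → Basic
  auxSet : ℕ → Bool → Basic

data Prim : Set where
  plain : Basic → Prim
  ptest : Basic → Prim
  ntest : Basic → Prim
  jump  : ℕ → Prim
  halt  : Prim

InstrSeq : Set
InstrSeq = List Prim

record State : Set where
  constructor st
  field
    inp : ℕ → Bool
    out : Bool
    aux : ℕ → Bool
open State public

execBasic : Basic → State → Bool × State
execBasic (inGet i)    s = inp s i , s
execBasic (outSet b)   s = b , st (inp s) b (aux s)
execBasic (auxGet i)   s = aux s i , s
execBasic (auxSet i b) s =
  b , st (inp s) (out s) (λ j → if (j Data.Nat.≡ᵇ i) then b else aux s j)

_‼_ : {A : Set} → List A → ℕ → Maybe A
[]       ‼ _       = nothing
(x ∷ _)  ‼ zero    = just x
(_ ∷ xs) ‼ (suc k) = xs ‼ k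

-- run fuel X pc s : execute X from the instruction at (0-based) position pc
-- in state s for at most `fuel` steps; `just s'` iff execution terminates
-- (reaches !) within that many steps, with final state s'.  Proceeding to a
-- nonexistent instruction never terminates (result nothing for every fuel),
-- and #0 loops forever.
run : ℕ → InstrSeq → ℕ → State → Maybe State
run zero       X pc s = nothing
run (suc fuel) X pc s with X ‼ pc
... | nothing = nothing
... | just halt = just s
... | just (jump l) = run fuel X (pc + l) s
... | just (plain a) with execBasic a s
...   | _ , s' = run fuel X (suc pc) s'
run (suc fuel) X pc s | just (ptest a) with execBasic a s
...   | true  , s' = run fuel X (suc pc) s'
...   | false , s' = run fuel X (suc (suc pc)) s'
run (suc fuel) X pc s | just (ntest a) with execBasic a s
...   | false , s' = run fuel X (suc pc) s'
...   | true  , s' = run fuel X (suc (suc pc)) s'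

-- Initial contents of in:i from an input vector b₁ … bₙ (1-based;
-- in:i for i = 0 or i > n is irrelevant for the sequences considered and set to 0).
inputs : (n : ℕ) → (Fin n → Bool) → ℕ → Bool
inputs n b zero    = false
inputs n b (suc i) with i <? n
... | yes i<n = b (fromℕ< i<n)
... | no  _   = false

-- The contents of aux:j for j = 0 or j > k are left arbitrary.
Computes : (n : ℕ) → ((Fin n → Bool) → Bool) → InstrSeq → Set
Computes n f X =
  Σ ℕ λ k → (b : Fin n → Bool) (a : ℕ → Bool) →
    ((j : ℕ) → 1 ≤ j → j ≤ k → a j ≡ false) →
    Σ ℕ λ fuel → Σ State λ s' →
      (run fuel X 0 (st (inputs n b) false a) ≡ just s') × (out s' ≡ f b)

tstnz : (n : ℕ) → (Fin n → Bool) → Bool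
tstnz n b = any b (allFin n)

block : ℕ → ℕ → InstrSeq
block a c = ntest (inGet a) ∷ ptest (inGet c) ∷ plain (outSet true) ∷ []

blocks : ℕ → ℕ → InstrSeq
blocks off zero    = []
blocks off (suc m) = blocks off m ++ block (off + (2 * m + 1)) (off + (2 * m + 2))

isEven : ℕ → Bool
isEven zero    = true
isEven (suc n) = not (isEven n)

-- TSTNZ'_n.  For even n, n/2 = ⌊n/2⌋; for odd n, (n-1)/2 = ⌊n/2⌋.
TSTNZ′ : ℕ → InstrSeq
TSTNZ′ n with isEven n
... | true  = blocks 0 ⌊ n /2⌋ ++ (halt ∷ [])
... | false = ptest (inGet 1) ∷ plain (outSet true) ∷ (blocks 1 ⌊ n /2⌋ ++ (halt ∷ []))

-- Renaming of input register names by a bijection ρ of {1,…,n}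
-- (represented as ρ : Fin n ↔ Fin n, with j ∈ {1..n} ↦ 1 + toℕ (ρ (j-1))).
renameIdx : {n : ℕ} → Fin n ↔ Fin n → ℕ → ℕ
renameIdx {n} ρ zero    = zero
renameIdx {n} ρ (suc i) with i <? n
... | yes i<n = suc (toℕ (Inverse.to ρ (fromℕ< i<n)))
... | no  _   = suc i

renameBasic : {n : ℕ} → Fin n ↔ Fin n → Basic → Basic
renameBasic ρ (inGet i)    = inGet (renameIdx ρ i)
renameBasic ρ (outSet b)   = outSet b
renameBasic ρ (auxGet i)   = auxGet i
renameBasic ρ (auxSet i b) = auxSet i b

renamePrim : {n : ℕ} → Fin n ↔ Fin n → Prim → Prim
renamePrim ρ (plain a) = plain (renameBasic ρ a)
renamePrim ρ (ptest a) = ptest (renameBasic ρ a)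
renamePrim ρ (ntest a) = ntest (renameBasic ρ a)
renamePrim ρ (jump l)  = jump l
renamePrim ρ halt      = halt

renameIS : {n : ℕ} → Fin n ↔ Fin n → InstrSeq → InstrSeq
renameIS ρ = Data.List.map (renamePrim ρ)

-- Run from a state with out = o, the block -in:a.get ; +in:c.get ; out.set:1 sets out to
-- in:a ∨ in:c ∨ o and falls through to the next instruction, and so does +in:x.get ; out.set:1
-- with in:x.  Hence the renamed TSTNZ'_n halts with out = in:ρ(1) ∨ … ∨ in:ρ(n), which is the
-- disjunction of all inputs because ρ permutes {1, …, n}.
module Submission where

open import Defs
open import Data.Bool using (Bool; true; false; _∨_; T; if_then_else_)
open import Data.Bool.Properties using (∨-assoc; ∨-comm; ∨-identityʳ; T-∨; T-≡; ⇔→≡; not-involutive)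
open import Data.Fin using (Fin; toℕ) renaming (zero to fzero; suc to fsuc)
open import Data.Fin.Properties using (toℕ<n; fromℕ<-toℕ)
open import Data.List using ([]; _∷_; _++_; length; allFin)
open import Data.List.Properties using (++-assoc; map-++)
open import Data.List.Membership.Propositional using (lose)
open import Data.List.Membership.Propositional.Properties using (∈-allFin)
open import Data.List.Relation.Unary.Any using (satisfied)
open import Data.List.Relation.Unary.Any.Properties using (any⁺; any⁻)
open import Data.Maybe using (just; nothing)
open import Data.Nat using (ℕ; zero; suc; _+_; _*_; _≤_; ⌊_/2⌋; _<?_)
open import Data.Nat.Properties using (+-assoc; +-comm; *-suc)
open import Data.Product using (Σ; ∃; _,_)
open import Data.Product.Function.Dependent.Propositional using (Σ-⇔)
open import Data.Sum using (inj₁; inj₂)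
open import Function using (_∘_; _⇔_; _↔_; mk⇔; Equivalence; Inverse)
import Function.Properties.Equivalence as ⇔
open import Function.Properties.Inverse using (↔⇒↠)
open import Function.Related.Propositional using (≡⇒; module EquationalReasoning)
open import Relation.Binary.PropositionalEquality using (_≡_; refl; sym; trans; cong; cong₂; subst₂; module ≡-Reasoning)
open import Relation.Nullary using (yes; no; contradiction)

run-∷ : ∀ fuel x X pc s → run fuel (x ∷ X) (suc pc) s ≡ run fuel X pc s
run-∷ zero       x X pc s = refl
run-∷ (suc fuel) x X pc s with X ‼ pc
... | nothing       = refl
... | just halt     = refl
... | just (jump l) = run-∷ fuel x X (pc + l) s
... | just (plain a) = run-∷ fuel x X (suc pc) _
... | just (ptest a) with execBasic a s
...   | true  , s′ = run-∷ fuel x X (suc pc) s′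
...   | false , s′ = run-∷ fuel x X (suc (suc pc)) s′
run-∷ (suc fuel) x X pc s | just (ntest a) with execBasic a s
...   | false , s′ = run-∷ fuel x X (suc pc) s′
...   | true  , s′ = run-∷ fuel x X (suc (suc pc)) s′

run-++ : ∀ fuel P Q pc s → run fuel (P ++ Q) (length P + pc) s ≡ run fuel Q pc s
run-++ fuel []      Q pc s = refl
run-++ fuel (x ∷ P) Q pc s = trans (run-∷ fuel x (P ++ Q) (length P + pc) s) (run-++ fuel P Q pc s)

-- Started in s, P leaves through its end in s′, whatever instructions follow it.
_⟨_⟩↦_ : State → InstrSeq → State → Set
s ⟨ P ⟩↦ s′ = Σ ℕ λ steps → ∀ R fuel → run (steps + fuel) (P ++ R) 0 s ≡ run fuel R 0 s′

↦-++ : ∀ {s s′ s″ P Q} → s ⟨ P ⟩↦ s′ → s′ ⟨ Q ⟩↦ s″ → s ⟨ P ++ Q ⟩↦ s″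
↦-++ {s} {s′} {s″} {P} {Q} (k , P↦) (k′ , Q↦) = k + k′ , λ R fuel → begin
  run ((k + k′) + fuel) ((P ++ Q) ++ R) 0 s ≡⟨ cong₂ (λ f X → run f X 0 s) (+-assoc k k′ fuel) (++-assoc P Q R) ⟩
  run (k + (k′ + fuel)) (P ++ (Q ++ R)) 0 s ≡⟨ P↦ (Q ++ R) (k′ + fuel) ⟩
  run (k′ + fuel) (Q ++ R) 0 s′             ≡⟨ Q↦ R fuel ⟩
  run fuel R 0 s″                           ∎
  where open ≡-Reasoning

_⟨_⟩⇓_ : State → InstrSeq → State → Set
s ⟨ P ⟩⇓ s′ = Σ ℕ λ fuel → run fuel P 0 s ≡ just s′

↦-halt : ∀ {s s′ P} → s ⟨ P ⟩↦ s′ → s ⟨ P ++ halt ∷ [] ⟩⇓ s′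
↦-halt (k , P↦) = k + 1 , P↦ (halt ∷ []) 1

testSet : ℕ → InstrSeq
testSet x = ptest (inGet x) ∷ plain (outSet true) ∷ []

-- The reply of a test is buried in the with-clauses of run, so the case split on it
-- only takes effect after rewrite has normalised the goal.
testSet-↦ : ∀ x I o A → st I o A ⟨ testSet x ⟩↦ st I (I x ∨ o) A
testSet-↦ x I o A = steps , falls
  where
  steps : ℕ
  steps = if I x then 2 else 1
  falls : ∀ R fuel → run (steps + fuel) (testSet x ++ R) 0 (st I o A) ≡ run fuel R 0 (st I (I x ∨ o) A)
  falls R fuel with I x in ix
  ... | true  rewrite ix = run-++ fuel (testSet x) R 0 _
  ... | false rewrite ix = run-++ fuel (testSet x) R 0 _

block-↦ : ∀ a c I o A → st I o A ⟨ block a c ⟩↦ st I (I a ∨ (I c ∨ o)) A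
block-↦ a c I o A = steps , falls
  where
  steps : ℕ
  steps = if I a then 2 else if I c then 3 else 2
  falls : ∀ R fuel → run (steps + fuel) (block a c ++ R) 0 (st I o A) ≡ run fuel R 0 (st I (I a ∨ (I c ∨ o)) A)
  falls R fuel with I a in ia | I c in ic
  ... | true  | _     rewrite ia       = run-++ fuel (block a c) R 0 _
  ... | false | true  rewrite ia | ic  = run-++ fuel (block a c) R 0 _
  ... | false | false rewrite ia | ic  = run-++ fuel (block a c) R 0 _

anyUpTo : (ℕ → Bool) → ℕ → Bool
anyUpTo g zero    = false
anyUpTo g (suc k) = g 1 ∨ anyUpTo (g ∘ suc) k

anyUpTo-suc : ∀ g k → anyUpTo g (suc k) ≡ anyUpTo g k ∨ g (suc k)
anyUpTo-suc g zero    = ∨-identityʳ (g 1)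
anyUpTo-suc g (suc k) = trans (cong (g 1 ∨_) (anyUpTo-suc (g ∘ suc) k)) (sym (∨-assoc (g 1) _ _))

T-anyUpTo : ∀ g k → T (anyUpTo g k) ⇔ ∃ λ (i : Fin k) → T (g (suc (toℕ i)))
T-anyUpTo g k = mk⇔ (to g k) (from g k)
  where
  to : ∀ g k → T (anyUpTo g k) → ∃ λ (i : Fin k) → T (g (suc (toℕ i)))
  to g (suc k) t with Equivalence.to T-∨ t
  ... | inj₁ u = fzero , u
  ... | inj₂ u with to (g ∘ suc) k u
  ...   | i , v = fsuc i , v
  from : ∀ g k → (∃ λ (i : Fin k) → T (g (suc (toℕ i)))) → T (anyUpTo g k)
  from g (suc k) (fzero  , u) = Equivalence.from T-∨ (inj₁ u)
  from g (suc k) (fsuc i , u) = Equivalence.from T-∨ (inj₂ (from (g ∘ suc) k (i , u)))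

anyUpTo-2*suc : ∀ g m → anyUpTo g (2 * suc m) ≡ anyUpTo g (2 * m) ∨ (g (2 * m + 1) ∨ g (2 * m + 2))
anyUpTo-2*suc g m = begin
  anyUpTo g (2 * suc m)                       ≡⟨ cong (anyUpTo g) (*-suc 2 m) ⟩
  anyUpTo g (suc (suc k))                     ≡⟨ anyUpTo-suc g (suc k) ⟩
  anyUpTo g (suc k) ∨ g (suc (suc k))         ≡⟨ cong (_∨ g (suc (suc k))) (anyUpTo-suc g k) ⟩
  (anyUpTo g k ∨ g (suc k)) ∨ g (suc (suc k)) ≡⟨ ∨-assoc (anyUpTo g k) _ _ ⟩
  anyUpTo g k ∨ (g (suc k) ∨ g (suc (suc k))) ≡⟨ cong₂ (λ i j → anyUpTo g k ∨ (g i ∨ g j)) (+-comm 1 k) (+-comm 2 k) ⟩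
  anyUpTo g k ∨ (g (k + 1) ∨ g (k + 2))       ∎
  where
  open ≡-Reasoning
  k = 2 * m

isEven⇒2*⌊n/2⌋≡n : ∀ n → isEven n ≡ true → 2 * ⌊ n /2⌋ ≡ n
isEven⇒2*⌊n/2⌋≡n zero          _    = refl
isEven⇒2*⌊n/2⌋≡n (suc (suc n)) even =
  trans (*-suc 2 ⌊ n /2⌋) (cong (suc ∘ suc) (isEven⇒2*⌊n/2⌋≡n n (trans (sym (not-involutive _)) even)))

isOdd⇒1+2*⌊n/2⌋≡n : ∀ n → isEven n ≡ false → suc (2 * ⌊ n /2⌋) ≡ n
isOdd⇒1+2*⌊n/2⌋≡n (suc zero)    _   = refl
isOdd⇒1+2*⌊n/2⌋≡n (suc (suc n)) odd =
  trans (cong suc (*-suc 2 ⌊ n /2⌋)) (cong (suc ∘ suc) (isOdd⇒1+2*⌊n/2⌋≡n n (trans (sym (not-involutive _)) odd)))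

inputs-suc-toℕ : ∀ {n} (b : Fin n → Bool) i → inputs n b (suc (toℕ i)) ≡ b i
inputs-suc-toℕ {n} b i with toℕ i <? n
... | yes i<n = cong b (fromℕ<-toℕ i i<n)
... | no  i≮n = contradiction (toℕ<n i) i≮n

renameIdx-suc-toℕ : ∀ {n} (ρ : Fin n ↔ Fin n) i → renameIdx ρ (suc (toℕ i)) ≡ suc (toℕ (Inverse.to ρ i))
renameIdx-suc-toℕ {n} ρ i with toℕ i <? n
... | yes i<n = cong (suc ∘ toℕ ∘ Inverse.to ρ) (fromℕ<-toℕ i i<n)
... | no  i≮n = contradiction (toℕ<n i) i≮n

T-tstnz : ∀ n b → T (tstnz n b) ⇔ ∃ λ i → T (b i)
T-tstnz n b = mk⇔ (satisfied ∘ any⁻ b (allFin n)) (λ (i , u) → any⁺ b (lose (∈-allFin i) u))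

T-⇔→≡ : ∀ {x y} → T x ⇔ T y → x ≡ y
T-⇔→≡ x⇔y = ⇔→≡ {z = true} (⇔.trans (⇔.sym T-≡) (⇔.trans x⇔y T-≡))

module _ {n : ℕ} (ρ : Fin n ↔ Fin n) where

  private
    r : ℕ → ℕ
    r = renameIdx ρ

  blocks-↦ : ∀ off m I o A →
    st I o A ⟨ renameIS ρ (blocks off m) ⟩↦ st I (anyUpTo (λ j → I (r (off + j))) (2 * m) ∨ o) A
  blocks-↦ off zero    I o A = 0 , λ R fuel → refl
  blocks-↦ off (suc m) I o A =
    subst₂ (λ P o′ → st I o A ⟨ P ⟩↦ st I o′ A)
      (sym (map-++ (renamePrim ρ) (blocks off m) (block (off + (2 * m + 1)) (off + (2 * m + 2)))))
      out≡
      (↦-++ (blocks-↦ off m I o A) (block-↦ _ _ I _ A))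
    where
    open ≡-Reasoning
    h : ℕ → Bool
    h j = I (r (off + j))
    x = h (2 * m + 1)
    y = h (2 * m + 2)
    F = anyUpTo h (2 * m)
    out≡ : x ∨ (y ∨ (F ∨ o)) ≡ anyUpTo h (2 * suc m) ∨ o
    out≡ = begin
      x ∨ (y ∨ (F ∨ o))   ≡⟨ sym (∨-assoc x y _) ⟩
      (x ∨ y) ∨ (F ∨ o)   ≡⟨ sym (∨-assoc _ F o) ⟩
      ((x ∨ y) ∨ F) ∨ o   ≡⟨ cong (_∨ o) (∨-comm _ F) ⟩
      (F ∨ (x ∨ y)) ∨ o   ≡⟨ cong (_∨ o) (sym (anyUpTo-2*suc h m)) ⟩
      anyUpTo h (2 * suc m) ∨ o ∎

  TSTNZ′-⇓ : ∀ I A → st I false A ⟨ renameIS ρ (TSTNZ′ n) ⟩⇓ st I (anyUpTo (I ∘ r) n) A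
  TSTNZ′-⇓ I A with isEven n in parity
  ... | true = subst₂ (λ P o → st I false A ⟨ P ⟩⇓ st I o A)
      (sym (map-++ (renamePrim ρ) (blocks 0 ⌊ n /2⌋) (halt ∷ [])))
      (trans (∨-identityʳ _) (cong (anyUpTo (I ∘ r)) (isEven⇒2*⌊n/2⌋≡n n parity)))
      (↦-halt (blocks-↦ 0 ⌊ n /2⌋ I false A))
  ... | false = subst₂ (λ P o → st I false A ⟨ P ⟩⇓ st I o A)
      (cong (testSet (r 1) ++_)
            (sym (map-++ (renamePrim ρ) (blocks 1 ⌊ n /2⌋) (halt ∷ []))))
      (trans (cong (F ∨_) (∨-identityʳ (I (r 1))))
             (trans (∨-comm F _) (cong (anyUpTo (I ∘ r)) (isOdd⇒1+2*⌊n/2⌋≡n n parity))))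
      (↦-halt (↦-++ (testSet-↦ (r 1) I false A) (blocks-↦ 1 ⌊ n /2⌋ I _ A)))
    where
    F = anyUpTo (I ∘ r ∘ suc) (2 * ⌊ n /2⌋)

  anyUpTo-inputs-renameIdx : ∀ b → anyUpTo (inputs n b ∘ r) n ≡ tstnz n b
  anyUpTo-inputs-renameIdx b = T-⇔→≡ (begin
    T (anyUpTo (inputs n b ∘ r) n)              ∼⟨ T-anyUpTo (inputs n b ∘ r) n ⟩
    ∃ (λ i → T (inputs n b (r (suc (toℕ i)))))  ∼⟨ Σ-⇔ (↔⇒↠ ρ) (λ {i} → ≡⇒ (cong T (input-ρ i))) ⟩
    ∃ (λ i → T (b i))                           ∼⟨ ⇔.sym (T-tstnz n b) ⟩
    T (tstnz n b)                               ∎)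
    where
    open EquationalReasoning
    input-ρ : ∀ i → inputs n b (r (suc (toℕ i))) ≡ b (Inverse.to ρ i)
    input-ρ i = trans (cong (inputs n b) (renameIdx-suc-toℕ ρ i)) (inputs-suc-toℕ b (Inverse.to ρ i))

proposition4 : (n : ℕ) → 1 ≤ n → (ρ : Fin n ↔ Fin n) →
    Computes n (tstnz n) (renameIS ρ (TSTNZ′ n))
proposition4 n _ ρ = 0 , λ b a _ →
  let fuel , halts = TSTNZ′-⇓ ρ (inputs n b) a
  in fuel , _ , halts , anyUpTo-inputs-renameIdx ρ b
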